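{- For every name $Q$: if $\eta\,Q\,\mathit{Region}$, then there exists $R$ with $\eta\,R\,(klass\,(\mathit{InteriorPoint}\,Q))$.
   Context: Setting: a Coq formalization (classical logic) of Leśniewski's Ontology and Mereology extended with Tarski's geometry of solids. Names form a type $N$ with a primitive relation $\eta:N\to N\to\mathrm{Prop}$ satisfying Leśniewski's ontological axiom $\eta\,A\,b \leftrightarrow ((\exists C,\eta\,C\,A)\wedge(\forall C\,D,\eta\,C\,A\wedge\eta\,D\,A\to\eta\,C\,D)\wedge(\forall C,\eta\,C\,A\to\eta\,C\,b))$; $A$ is an individual iff $\eta\,A\,A$; $a\subseteq b$ means $\forall P,\eta\,P\,a\to\eta\,P\,b$. Mereology: $pt:N\to N$ ($\eta\,B\,(pt\,A)$: $B$ is a part of $A$) satisfying Leśniewski's mereology axioms (part-of a partial order on individuals; every non-empty name has a unique m-class). M-class: $\eta\,A\,(klass\,a)$ iff $\eta\,A\,A$, $\forall B,\eta\,B\,a\to\eta\,B\,(pt\,A)$, and $\forall B,\eta\,B\,(pt\,A)\to\exists C\,D,\eta\,C\,a\wedge\eta\,D\,(pt\,C)\wedge\eta\,D\,(pt\,B)$. $X$ is exterior to $Y$ iff they have no common part. Geometry: $\mathit{balls}$ is a primitive name (there exists at least one ball). Tarski's definitions for balls: $A$ is externally tangent to $B$ iff $A$ is exterior to $B$ and for any balls $X,Y$ both having $A$ as part and both exterior to $B$, one of $X,Y$ is part of the other; $A$ is internally tangent to $B$ iff $A$ is a proper part of $B$ and for any balls $X,Y$ both having $A$ as a part and both parts of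 $B$, one of $X,Y$ is part of the other; $A,B$ are externally diametrical w.r.t. $C$ iff both are externally tangent to $C$ and for any balls $X,Y$ exterior to $C$ with $A$ part of $X$ and $B$ part of $Y$, $X$ is exterior to $Y$; $A,B$ are internally diametrical w.r.t. $C$ iff both are internally tangent to $C$ and for any balls $X,Y$ externally tangent to $C$ with $A$ exterior to $X$ and $B$ exterior to $Y$, $X$ is exterior to $Y$; $A$ is concentric with $B$ iff $A=B$, or $A$ is a proper part of $B$ and any balls $X,Y$ externally diametrical w.r.t. $A$ and internally tangent to $B$ are internally diametrical w.r.t. $B$, or the same holds with $A,B$ interchanged. $\eta\,P\,(\mathit{Concent}\,Q)$ iff $P,Q$ are balls and $P$ is concentric with $Q$. Point: $\eta\,P\,(\mathit{Point}\,Q)$ iff $\eta\,P\,\mathit{balls}\wedge\eta\,Q\,\mathit{balls}\wedge\eta\,P\,(\mathit{Concent}\,Q)$. Region: $\eta\,P\,\mathit{Region}$ iff $\eta\,P\,P$ and $\exists b,\ b\subseteq\mathit{balls}\wedge\eta\,P\,(klass\,b)$. Interior point: $\eta\,P\,(\mathit{InteriorPoint}\,Q)$ iff $\eta\,Q\,\mathit{Region}$ and $\exists P',\ \eta\,P\,(\mathit{Point}\,P')\wedge\eta\,P'\,(pt\,Q)$. -}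

module Defs where

open import Data.Product using (Σ; ∃; ∃-syntax; _×_; _,_)
open import Data.Sum using (_⊎_)
open import Relation.Nullary using (¬_)
open import Function.Bundles using (_⇔_)

module Notions (N : Set) (η : N → N → Set) (pt : N → N) where

  individual : N → Set
  individual A = η A A

  _⊆_ : N → N → Set
  a ⊆ b = ∀ P → η P a → η P b

  _≐_ : N → N → Set
  A ≐ B = η A B × η B A

  IsKlass : N → N → Set
  IsKlass A a =
    η A A × (∀ B → η B a → η B (pt A))
          × (∀ B → η B (pt A) → ∃[ C ] ∃[ D ] (η C a × η D (pt C) × η D (pt B)))

  exterior : N → N → Set
  exterior X Y = ¬ (∃[ Z ] (η Z (pt X) × η Z (pt Y)))

  properPart : N → N → Set
  properPart A B = η A (pt B) × ¬ (A ≐ B)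

  module WithBalls (balls : N) where

    extTangent : N → N → Set
    extTangent A B =
      exterior A B ×
      (∀ X Y → η X balls → η Y balls →
        η A (pt X) → η A (pt Y) → exterior X B → exterior Y B →
        η X (pt Y) ⊎ η Y (pt X))

    intTangent : N → N → Set
    intTangent A B =
      properPart A B ×
      (∀ X Y → η X balls → η Y balls →
        η A (pt X) → η A (pt Y) → η X (pt B) → η Y (pt B) →
        η X (pt Y) ⊎ η Y (pt X))

    extDiametrical : N → N → N → Set
    extDiametrical A B C =
      extTangent A C × extTangent B C ×
      (∀ X Y → η X balls → η Y balls →
        exterior X C → exterior Y C → η A (pt X) → η B (pt Y) →
        exterior X Y)

    intDiametrical : N → N → N → Set
    intDiametrical A B C =
      intTangent A C × intTangent B C ×
      (∀ X Y → η X balls → η Y balls →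
        extTangent X C → extTangent Y C → exterior A X → exterior B Y →
        exterior X Y)

    concentricAux : N → N → Set
    concentricAux A B =
      properPart A B ×
      (∀ X Y → η X balls → η Y balls →
        extDiametrical X Y A → intTangent X B → intTangent Y B →
        intDiametrical X Y B)

    concentric : N → N → Set
    concentric A B = (A ≐ B) ⊎ concentricAux A B ⊎ concentricAux B A

-- The whole theory: Ontology + Mereology + Tarski's geometry of solids,
-- in classical logic, with name-forming functors introduced by their
-- defining axioms (as in Leśniewski's systems).
record Theory : Set₁ where
  field
    N  : Set
    η  : N → N → Set
    classical : (P : Set) → P ⊎ ¬ P
    ontology : ∀ A b →
      η A b ⇔ ((∃[ C ] η C A) × (∀ C D → η C A → η D A → η C D)
                × (∀ C → η C A → η C b))
    pt    : N → N
    klass : N → N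

  open Notions N η pt public

  field
    pt-individuals : ∀ A B → η B (pt A) → individual A × individual B
    pt-refl  : ∀ A → individual A → η A (pt A)
    pt-antisym : ∀ A B → η A (pt B) → η B (pt A) → A ≐ B
    pt-trans : ∀ A B C → η A (pt B) → η B (pt C) → η A (pt C)
    klass-def : ∀ A a → η A (klass a) ⇔ IsKlass A a
    klass-exists : ∀ a → (∃[ A ] η A a) → ∃[ B ] η B (klass a)
    klass-unique : ∀ a A B → η A (klass a) → η B (klass a) → η A B
    balls : N
    balls-nonempty : ∃[ B ] η B balls

  open WithBalls balls public

  field
    Concent : N → N
    Concent-def : ∀ P Q →
      η P (Concent Q) ⇔ (η P balls × η Q balls × concentric P Q)
    Point : N → N
    Point-def : ∀ P Q →
      η P (Point Q) ⇔ (η P balls × η Q balls × η P (Concent Q))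
    Region : N
    Region-def : ∀ P →
      η P Region ⇔ (η P P × ∃[ b ] (b ⊆ balls × η P (klass b)))
    InteriorPoint : N → N
    InteriorPoint-def : ∀ P Q →
      η P (InteriorPoint Q) ⇔
        (η Q Region × ∃[ P' ] (η P (Point P') × η P' (pt Q)))

module Submission where

open import Defs
open import Data.Product using (∃; ∃-syntax; _×_; _,_)
open import Data.Sum using (inj₁)
open import Function.Bundles using (Equivalence)

-- A region is the m-class of some balls, so it has a ball C as a part; C is
-- concentric with itself, hence a point of itself, hence an interior point of
-- the region.  So InteriorPoint Q is non-empty, and non-empty names have an m-class.

module _ (T : Theory) where
  open Theory T

  η⇒individual : ∀ {A b} → η A b → individual A
  η⇒individual {A} {b} Ab with Equivalence.to (ontology A b) Ab
  ... | nonempty , unique , _ =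
    Equivalence.from (ontology A A) (nonempty , unique , λ _ CA → CA)

  ball-part-of-Region : ∀ {Q} → η Q Region → ∃[ C ] (η C balls × η C (pt Q))
  ball-part-of-Region {Q} QR with Equivalence.to (Region-def Q) QR
  ... | QQ , b , b⊆balls , Q∈klass-b
    with Equivalence.to (klass-def Q b) Q∈klass-b
  ... | _ , b⊆ptQ , ptQ-meets-b
    with ptQ-meets-b Q (pt-refl Q QQ)
  ... | C , _ , Cb , _ = C , b⊆balls C Cb , b⊆ptQ C Cb

  ball-Point-self : ∀ {C} → η C balls → η C (Point C)
  ball-Point-self {C} Cball =
    Equivalence.from (Point-def C C) (Cball , Cball , C-Concent-C)
    where
    CC : individual C
    CC = η⇒individual Cball

    C-Concent-C : η C (Concent C)
    C-Concent-C = Equivalence.from (Concent-def C C) (Cball , Cball , inj₁ (CC , CC))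

  ball-part-InteriorPoint : ∀ {C Q} → η Q Region → η C balls → η C (pt Q) →
                            η C (InteriorPoint Q)
  ball-part-InteriorPoint {C} {Q} QR Cball CptQ =
    Equivalence.from (InteriorPoint-def C Q) (QR , C , ball-Point-self Cball , CptQ)

  InteriorPoint-nonempty : ∀ {Q} → η Q Region → ∃[ C ] η C (InteriorPoint Q)
  InteriorPoint-nonempty QR with ball-part-of-Region QR
  ... | C , Cball , CptQ = C , ball-part-InteriorPoint QR Cball CptQ

theorem3 : (T : Theory) → let open Theory T in
    ∀ Q → η Q Region → ∃[ R ] η R (klass (InteriorPoint Q))
theorem3 T Q QR = klass-exists (InteriorPoint Q) (InteriorPoint-nonempty T QR)
  where open Theory T
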